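{- Let $R$ be a commutative ring with identity and let $I$ be an ideal of $R$. Identify the amalgamated duplication $R\Join I$ with the set $R\oplus I=\{(r,i)\mid r\in R,\ i\in I\}$ equipped with componentwise addition and the multiplication $(r,i)(s,j)=(rs,\,rj+si+ij)$. Then the set of zero-divisors of this ring is \[ \mathrm{Z}(R\Join I)=\{(0,i)\mid i\in I\}\cup\{(i,-i)\mid i\in I\}\cup\{(x,i)\mid x\in \mathrm{Z}(R)\setminus\{0\},\ i\in I\}\cup\{(x,i)\mid x\in R\setminus \mathrm{Z}(R),\ i\in I,\ \text{there exists } 0\neq j\in I \text{ with } j(x+i)=0\}. \]
   Context: For a commutative ring $A$, $\mathrm{Z}(A)$ denotes the set of zero-divisors of $A$ (elements $a$ for which there is $b\neq 0$ with $ab=0$); in particular $0\in \mathrm{Z}(A)$. The amalgamated duplication of $R$ along $I$ is the subring $R\Join I=\{(r,r+i)\mid r\in R,\ i\in I\}$ of $R\times R$; the map $(r,i)\mapsto (r,r+i)$ is a ring isomorphism from $R\oplus I$ with the multiplication $(r,i)(s,j)=(rs,rj+si+ij)$ onto $R\Join I$. -}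

module Defs where

open import Level using (Level; _⊔_)
open import Algebra.Bundles using (CommutativeRing)
open import Data.Product using (Σ; Σ-syntax; ∃; _×_; _,_)
open import Data.Sum using (_⊎_)
open import Relation.Nullary using (¬_)

ZeroDivisor : ∀ {a ℓ} {A : Set a} (_≈_ : A → A → Set ℓ) (0# : A) (_*_ : A → A → A) → A → Set (a ⊔ ℓ)
ZeroDivisor {A = A} _≈_ 0# _*_ x = Σ[ b ∈ A ] (¬ (b ≈ 0#)) × ((x * b) ≈ 0#)

module _ {c ℓ} (R : CommutativeRing c ℓ) where
  open CommutativeRing R

  Z : Carrier → Set (c ⊔ ℓ)
  Z = ZeroDivisor _≈_ 0# _*_

  record IsIdeal {p} (I : Carrier → Set p) : Set (c ⊔ ℓ ⊔ p) where
    field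
      resp  : ∀ {x y} → x ≈ y → I x → I y
      zero∈ : I 0#
      +∈    : ∀ {x y} → I x → I y → I (x + y)
      *∈    : ∀ r {x} → I x → I (r * x)

  module Dup {p} (I : Carrier → Set p) where
    R⊕I : Set (c ⊔ p)
    R⊕I = Carrier × Σ Carrier I

    _≈D_ : R⊕I → R⊕I → Set ℓ
    (r , (i , _)) ≈D (s , (j , _)) = (r ≈ s) × (i ≈ j)

    0D : I 0# → R⊕I
    0D z = (0# , (0# , z))

    mulD : IsIdeal I → R⊕I → R⊕I → R⊕I
    mulD isI (r , (i , ri)) (s , (j , sj)) =
      (r * s , ((r * j + s * i) + i * j
               , IsIdeal.+∈ isI (IsIdeal.+∈ isI (IsIdeal.*∈ isI r sj) (IsIdeal.*∈ isI s ri))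
                                 (IsIdeal.*∈ isI i sj)))

    ZDup : IsIdeal I → R⊕I → Set (c ⊔ ℓ ⊔ p)
    ZDup isI = ZeroDivisor _≈D_ (0D (IsIdeal.zero∈ isI)) (mulD isI)

    RHS : R⊕I → Set (c ⊔ ℓ ⊔ p)
    RHS (x , (k , _)) =
        (Σ[ i ∈ Carrier ] I i × (x ≈ 0#) × (k ≈ i))
      ⊎ ((Σ[ i ∈ Carrier ] I i × (x ≈ i) × (k ≈ - i))
      ⊎ (((Z x) × (¬ (x ≈ 0#)))
      ⊎ ((¬ Z x) × (Σ[ j ∈ Carrier ] I j × (¬ (j ≈ 0#)) × ((j * (x + k)) ≈ 0#)))))

{-# OPTIONS --safe #-}
module Submission where

open import Defs
open import Level using (_⊔_; Lift; lift; lower)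
open import Algebra.Bundles using (CommutativeRing)
open import Data.Maybe using (nothing)
open import Data.Product using (_×_; _,_; proj₁; proj₂)
open import Data.Sum using (inj₁; inj₂)
open import Function.Bundles using (_⇔_; mk⇔; Equivalence)
open import Relation.Nullary using (¬_; Dec; yes; no)
open import Relation.Nullary.Decidable using (map′; decidable-stable)
import Tactic.RingSolver.NonReflective as RingSolver
open import Tactic.RingSolver.Core.AlmostCommutativeRing
  using (AlmostCommutativeRing; fromCommutativeRing)
import Algebra.Properties.Ring as RingProperties
import Relation.Binary.Reasoning.Setoid as SetoidReasoning

-- Under (r , i) ↦ (r , r + i) the product in R ⊕ I becomes the coordinatewise product in
-- R × R, so (x , k) is a zero-divisor iff some (s , j) ≠ 0 has x s = 0 and (x + k)(s + j) = 0.
-- For x = 0 or x ∈ Z(R) such an (s , j) is built directly; for x ∉ Z(R) the first equation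
-- forces s = 0, leaving a nonzero j ∈ I that kills x + k.

module DuplicationZeroDivisors {c ℓ p} (R : CommutativeRing c ℓ)
  {I : CommutativeRing.Carrier R → Set p} (isI : IsIdeal R I) where

  open CommutativeRing R
  open IsIdeal isI
  open Dup R I
  open RingProperties ring using (-‿distribʳ-*; -0#≈0#)
  open SetoidReasoning setoid

  almostCommutativeRing : AlmostCommutativeRing c ℓ
  almostCommutativeRing = fromCommutativeRing R (λ _ → nothing)

  mulD-expansion : ∀ r i s j → ((r * j + s * i) + i * j) + r * s ≈ (r + i) * (s + j)
  mulD-expansion = solve 4 (λ r i s j → ((r ⊗ j ⊕ s ⊗ i) ⊕ i ⊗ j) ⊕ r ⊗ s ⊜ (r ⊕ i) ⊗ (s ⊕ j)) refl
    where open RingSolver almostCommutativeRing using (solve; _⊜_; _⊕_; _⊗_)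

  x≈0⇒x*y≈0 : ∀ {x} y → x ≈ 0# → x * y ≈ 0#
  x≈0⇒x*y≈0 y x≈0 = trans (*-congʳ x≈0) (zeroˡ y)

  Annihilates : R⊕I → R⊕I → Set ℓ
  Annihilates (r , i , _) (s , j , _) = (r * s ≈ 0#) × ((r + i) * (s + j) ≈ 0#)

  mulD≈0D⇔Annihilates : ∀ a b → mulD isI a b ≈D 0D zero∈ ⇔ Annihilates a b
  mulD≈0D⇔Annihilates (r , i , _) (s , j , _) =
    mk⇔ (λ (rs≈0 , e) → rs≈0 , trans (sym (second≈ rs≈0)) e)
        (λ (rs≈0 , e) → rs≈0 , trans (second≈ rs≈0) e)
    where
    second≈ : r * s ≈ 0# → (r * j + s * i) + i * j ≈ (r + i) * (s + j)
    second≈ rs≈0 = begin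
      (r * j + s * i) + i * j            ≈⟨ +-identityʳ _ ⟨
      ((r * j + s * i) + i * j) + 0#     ≈⟨ +-congˡ rs≈0 ⟨
      ((r * j + s * i) + i * j) + r * s  ≈⟨ mulD-expansion r i s j ⟩
      (r + i) * (s + j)                  ∎

  ZDup-intro : ∀ {x k} (kI : I k) {s j} (jI : I j) → ¬ (s ≈ 0# × j ≈ 0#) →
               x * s ≈ 0# → (x + k) * (s + j) ≈ 0# → ZDup isI (x , k , kI)
  ZDup-intro kI jI nonzero xs≈0 e =
    (_ , _ , jI) , nonzero , Equivalence.from (mulD≈0D⇔Annihilates (_ , _ , kI) (_ , _ , jI)) (xs≈0 , e)

  -- In R ⋈ I ⊆ R × R the witnesses of the next three lemmas are (s , s), (- j , 0) and (0 , j).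

  ZDup-byDiagonal : ∀ {x k} (kI : I k) {s} → ¬ s ≈ 0# → x * s ≈ 0# → k * s ≈ 0# →
                    ZDup isI (x , k , kI)
  ZDup-byDiagonal {x} {k} kI {s} s≉0 xs≈0 ks≈0 =
    ZDup-intro kI zero∈ (λ (s≈0 , _) → s≉0 s≈0) xs≈0 (begin
      (x + k) * (s + 0#)  ≈⟨ *-congˡ (+-identityʳ s) ⟩
      (x + k) * s         ≈⟨ distribʳ s x k ⟩
      x * s + k * s       ≈⟨ +-cong xs≈0 ks≈0 ⟩
      0# + 0#             ≈⟨ +-identityʳ 0# ⟩
      0#                  ∎)

  ZDup-byFirstFactor : ∀ {x k} (kI : I k) {j} → I j → ¬ j ≈ 0# → x * j ≈ 0# →
                       ZDup isI (x , k , kI)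
  ZDup-byFirstFactor {x} {k} kI {j} jI j≉0 xj≈0 =
    ZDup-intro kI jI (λ (_ , j≈0) → j≉0 j≈0)
      (begin
        x * - j    ≈⟨ -‿distribʳ-* x j ⟨
        - (x * j)  ≈⟨ -‿cong xj≈0 ⟩
        - 0#       ≈⟨ -0#≈0# ⟩
        0#         ∎)
      (trans (*-congˡ (-‿inverseˡ j)) (zeroʳ (x + k)))

  ZDup-bySecondFactor : ∀ {x k} (kI : I k) {j} → I j → ¬ j ≈ 0# → (x + k) * j ≈ 0# →
                        ZDup isI (x , k , kI)
  ZDup-bySecondFactor {x} kI {j} jI j≉0 e =
    ZDup-intro kI jI (λ (_ , j≈0) → j≉0 j≈0) (zeroʳ x) (trans (*-congˡ (+-identityˡ j)) e)

  ZDup-zero : ¬ 1# ≈ 0# → ∀ {x k} (kI : I k) → x ≈ 0# → k ≈ 0# → ZDup isI (x , k , kI)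
  ZDup-zero 1≉0 kI x≈0 k≈0 = ZDup-byDiagonal kI 1≉0 (x≈0⇒x*y≈0 1# x≈0) (x≈0⇒x*y≈0 1# k≈0)

  module _ (_≟_ : ∀ x y → Dec (x ≈ y)) where

    RHS⇒ZDup : ¬ 1# ≈ 0# → ∀ a → RHS a → ZDup isI a
    RHS⇒ZDup 1≉0 (x , k , kI) (inj₁ (_ , _ , x≈0 , _)) with k ≟ 0#
    ... | yes k≈0 = ZDup-zero 1≉0 kI x≈0 k≈0
    ... | no k≉0  = ZDup-byFirstFactor kI kI k≉0 (x≈0⇒x*y≈0 k x≈0)
    RHS⇒ZDup 1≉0 (x , k , kI) (inj₂ (inj₁ (i , iI , x≈i , k≈-i))) with i ≟ 0#
    ... | yes i≈0 = ZDup-zero 1≉0 kI (trans x≈i i≈0) (trans k≈-i (trans (-‿cong i≈0) -0#≈0#))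
    ... | no i≉0  =
      ZDup-bySecondFactor kI iI i≉0 (x≈0⇒x*y≈0 i (trans (+-cong x≈i k≈-i) (-‿inverseʳ i)))
    RHS⇒ZDup 1≉0 (x , k , kI) (inj₂ (inj₂ (inj₁ ((y , y≉0 , xy≈0) , _)))) with (y * k) ≟ 0#
    ... | yes yk≈0 = ZDup-byDiagonal kI y≉0 xy≈0 (trans (*-comm k y) yk≈0)
    ... | no yk≉0  =
      ZDup-byFirstFactor kI (*∈ y kI) yk≉0 (trans (sym (*-assoc x y k)) (x≈0⇒x*y≈0 k xy≈0))
    RHS⇒ZDup 1≉0 (x , k , kI) (inj₂ (inj₂ (inj₂ (_ , j , jI , j≉0 , j[x+k]≈0)))) =
      ZDup-bySecondFactor kI jI j≉0 (trans (*-comm (x + k) j) j[x+k]≈0)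

    ¬Z⇒x*s≈0⇒s≈0 : ∀ {x s} → ¬ Z R x → x * s ≈ 0# → s ≈ 0#
    ¬Z⇒x*s≈0⇒s≈0 {s = s} x∉Z xs≈0 = decidable-stable (s ≟ 0#) (λ s≉0 → x∉Z (s , s≉0 , xs≈0))

    ZDup⇒RHS : (∀ x → Dec (Z R x)) → ∀ a → ZDup isI a → RHS a
    ZDup⇒RHS Z? (x , k , kI) ((s , j , jI) , nonzero , product≈0) with x ≟ 0# | Z? x
    ... | yes x≈0 | _       = inj₁ (k , kI , x≈0 , refl)
    ... | no x≉0  | yes x∈Z = inj₂ (inj₂ (inj₁ (x∈Z , x≉0)))
    ... | no _    | no x∉Z  =
      inj₂ (inj₂ (inj₂ (x∉Z , j , jI , (λ j≈0 → nonzero (s≈0 , j≈0)) , (begin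
        j * (x + k)        ≈⟨ *-comm j (x + k) ⟩
        (x + k) * j        ≈⟨ *-congˡ (+-identityˡ j) ⟨
        (x + k) * (0# + j) ≈⟨ *-congˡ (+-congʳ s≈0) ⟨
        (x + k) * (s + j)  ≈⟨ proj₂ annihilates ⟩
        0#                 ∎))))
      where
      annihilates : Annihilates (x , k , kI) (s , j , jI)
      annihilates = Equivalence.to (mulD≈0D⇔Annihilates (x , k , kI) (s , j , jI)) product≈0

      s≈0 : s ≈ 0#
      s≈0 = ¬Z⇒x*s≈0⇒s≈0 x∉Z (proj₁ annihilates)

lowerDec : ∀ {a b} {A : Set a} → Dec (Lift b A) → Dec A
lowerDec = map′ lower lift

proposition2p2 : ∀ {c ℓ p} (R : CommutativeRing c ℓ)
    → ((P : Set (c ⊔ ℓ ⊔ p)) → Dec P)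
    → ¬ (CommutativeRing._≈_ R (CommutativeRing.1# R) (CommutativeRing.0# R))
    → (I : CommutativeRing.Carrier R → Set p) (isI : IsIdeal R I)
    → (x : Dup.R⊕I R I) → Dup.ZDup R I isI x ⇔ Dup.RHS R I x
proposition2p2 {c} {ℓ} {p} R dec 1≉0 I isI a =
  mk⇔ (ZDup⇒RHS _≟_ Z? a) (RHS⇒ZDup _≟_ 1≉0 a)
  where
  open CommutativeRing R using (_≈_)
  open DuplicationZeroDivisors R isI

  _≟_ : ∀ x y → Dec (x ≈ y)
  x ≟ y = lowerDec (dec (Lift (c ⊔ ℓ ⊔ p) (x ≈ y)))

  Z? : ∀ x → Dec (Z R x)
  Z? x = lowerDec (dec (Lift (c ⊔ ℓ ⊔ p) (Z R x)))
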